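{- Let $n\ge 2$, let $\boldsymbol{\pi}\in\mathfrak{S}_n$ be an $Ln1$ permutation, and let $\mathcal{P}=\operatorname{conv}(\mathcal{S}^{\boldsymbol{\pi}})$. Then $\mathcal{P}$ contains at most $(n-1)!+(n-1)$ lattice points (counting vertices, boundary points and interior points), i.e. $|\mathcal{P}\cap\mathbb{Z}^n|\le (n-1)!+(n-1)$.
   Context: Permutations $\boldsymbol{\pi}=\pi_1\cdots\pi_n\in\mathfrak{S}_n$ are identified with points of $\mathbb{R}^n$; $\mathbf{e}=12\cdots n$. An $Ln1$ permutation is one with $\pi_{n-1}=n$ and $\pi_n=1$. The stack-sorting map $s$: start with an empty stack and read entries left to right; for each entry $x$, while the stack is nonempty and its top $t<x$, pop $t$ to the output; then push $x$. At the end, pop the remaining stack elements to the output; the output is $s(\boldsymbol{\pi})$. $\mathcal{S}^{\boldsymbol{\pi}}=\{\boldsymbol{\pi},s(\boldsymbol{\pi}),s^2(\boldsymbol{\pi}),\dots,\mathbf{e}\}$ (iterating until $\mathbf{e}$ is reached). -}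

module Defs where

open import Data.Bool using (if_then_else_)
open import Data.Nat using (ℕ; zero; suc; _<ᵇ_)
open import Data.Integer using (ℤ; +_)
open import Data.Rational using (ℚ; _/_; 0ℚ; 1ℚ; _+_; _*_; _≤_)
open import Data.List using (List; []; _∷_; _++_; map; upTo; zipWith; replicate; foldr; length)
open import Data.List.Relation.Binary.Permutation.Propositional using (_↭_)
open import Data.List.Relation.Unary.All using (All)
open import Data.Product using (_×_; _,_; proj₁; proj₂; Σ; ∃)
open import Relation.Binary.PropositionalEquality using (_≡_)

IsPerm : ℕ → List ℕ → Set
IsPerm n π = π ↭ map suc (upTo n)

IsLn1 : ℕ → List ℕ → Set
IsLn1 n π = ∃ λ (xs : List ℕ) → π ≡ xs ++ (n ∷ 1 ∷ [])

-- Stack-sorting map. Stacks are lists with the top at the head.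
-- popWhile x st pops (in order) all top elements t < x; returns (popped, remaining stack).
popWhile : ℕ → List ℕ → List ℕ × List ℕ
popWhile x [] = [] , []
popWhile x (t ∷ st) =
  if t <ᵇ x
  then (t ∷ proj₁ (popWhile x st) , proj₂ (popWhile x st))
  else ([] , t ∷ st)

stackGo : List ℕ → List ℕ → List ℕ
stackGo [] st = st
stackGo (x ∷ xs) st = proj₁ (popWhile x st) ++ stackGo xs (x ∷ proj₂ (popWhile x st))

s : List ℕ → List ℕ
s π = stackGo π []

iter : ℕ → List ℕ → List ℕ
iter zero π = π
iter (suc k) π = s (iter k π)

ℕtoℚ : ℕ → ℚ
ℕtoℚ m = (+ m) / 1

ℤtoℚ : ℤ → ℚ
ℤtoℚ z = z / 1

scaleAdd : ℚ → List ℕ → List ℚ → List ℚ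
scaleAdd c p acc = zipWith (λ x a → (c * ℕtoℚ x) + a) p acc

sumℚ : List ℚ → ℚ
sumℚ = foldr _+_ 0ℚ

combo : ℕ → List ℕ → List (ℚ × ℕ) → List ℚ
combo n π ws = foldr (λ w acc → scaleAdd (proj₁ w) (iter (proj₂ w) π) acc) (replicate n 0ℚ) ws

InConvOrbit : ℕ → List ℕ → List ℤ → Set
InConvOrbit n π z =
  Σ (List (ℚ × ℕ)) λ ws →
    All (λ w → 0ℚ ≤ proj₁ w) ws
    × sumℚ (map proj₁ ws) ≡ 1ℚ
    × map ℤtoℚ z ≡ combo n π ws

LatticePointOf : ℕ → List ℕ → List ℤ → Set
LatticePointOf n π z = length z ≡ n × InConvOrbit n π z

module Submission where

-- Write n = N + 1 and index coordinates from 0. The iterates of an Ln1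
-- permutation π form a staircase: sᵏ(π) has the entry 1 at coordinate N - k,
-- all later iterates carry the sorted value N - k + 1 there, and sᴺ(π) is the
-- identity. For a lattice point z = Σ c·sᵏ(π) of the hull let μₖ be the total
-- weight on sᵏ(π), k < N. Then z_{N-k} + (N - k)·μₖ depends only on μ₀ … μₖ₋₁.
-- If some μₖ = 1, z is the vertex sᵏ(π). Otherwise (N - k)·μₖ lies in
-- [0, N - k), and since z is integral its floor pins down μₖ once μ₀ … μₖ₋₁
-- are known; so z is determined by a vector of floors ranging over a box with
-- N! points. Hence there are at most N + N! lattice points.

open import Defs
open import Data.Empty using (⊥-elim)
open import Data.List
  using (List; []; _∷_; _++_; [_]; _∷ʳ_; map; length; replicate; zipWith; upTo; applyUpTo; cartesianProductWith)
open import Data.List.Relation.Unary.All as All using (All; []; _∷_; reduce)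
open import Data.Product using (_×_; _,_; proj₁; proj₂; ∃)
open import Data.Sum using (_⊎_; inj₁; inj₂)
open import Function using (_∘_)
open import Relation.Binary.PropositionalEquality
  using (_≡_; _≢_; refl; sym; trans; cong; cong₂; subst; subst₂; module ≡-Reasoning)
open import Relation.Nullary using (Dec; yes; no; ¬_; contradiction)

module Rational where

  open import Data.Nat as ℕ using (ℕ; zero; suc)
  import Data.Nat.Properties as ℕ
  open import Data.Nat.Coprimality as Coprime using (1-coprimeTo)
  open import Data.Integer as ℤ using (ℤ)
  import Data.Integer.Properties as ℤ
  open import Data.Rational
  open import Data.Rational.Properties
  open import Algebra.Properties.Group +-0-group using (∙-cancelˡ)
  open import Tactic.RingSolver using (solve-∀)
  open import Tactic.RingSolver.Core.AlmostCommutativeRing using (AlmostCommutativeRing; fromCommutativeRing)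
  open import Level using (0ℓ)
  open import Relation.Binary.Definitions using (tri<; tri≈; tri>)
  open import Relation.Nullary.Decidable using (dec⇒maybe)

  ℚ-ring : AlmostCommutativeRing 0ℓ 0ℓ
  ℚ-ring = fromCommutativeRing +-*-commutativeRing (λ x → dec⇒maybe (0ℚ ≟ x))

  ℤtoℚ≡mkℚ : ∀ i → ℤtoℚ i ≡ mkℚ i 0 (Coprime.sym (1-coprimeTo _))
  ℤtoℚ≡mkℚ (ℤ.+ m)    = normalize-coprime (Coprime.sym (1-coprimeTo m))
  ℤtoℚ≡mkℚ ℤ.-[1+ m ] = cong -_ (normalize-coprime (Coprime.sym (1-coprimeTo (suc m))))

  ℤtoℚ-injective : ∀ {a b} → ℤtoℚ a ≡ ℤtoℚ b → a ≡ b
  ℤtoℚ-injective {a} {b} eq = cong ↥_ (trans (sym (ℤtoℚ≡mkℚ a)) (trans eq (ℤtoℚ≡mkℚ b)))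

  ℤtoℚ-+ : ∀ a b → ℤtoℚ (a ℤ.+ b) ≡ ℤtoℚ a + ℤtoℚ b
  ℤtoℚ-+ a b rewrite ℤtoℚ≡mkℚ a | ℤtoℚ≡mkℚ b =
    cong₂ (λ x y → (x ℤ.+ y) / 1) (sym (ℤ.*-identityʳ a)) (sym (ℤ.*-identityʳ b))

  ℤtoℚ-mono-≤ : ∀ {a b} → a ℤ.≤ b → ℤtoℚ a ≤ ℤtoℚ b
  ℤtoℚ-mono-≤ {a} {b} a≤b rewrite ℤtoℚ≡mkℚ a | ℤtoℚ≡mkℚ b =
    *≤* (subst₂ ℤ._≤_ (sym (ℤ.*-identityʳ a)) (sym (ℤ.*-identityʳ b)) a≤b)

  ℕtoℚ-suc : ∀ m → ℕtoℚ (suc m) ≡ 1ℚ + ℕtoℚ m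
  ℕtoℚ-suc m = ℤtoℚ-+ ℤ.1ℤ (ℤ.+ m)

  ℕtoℚ-suc-positive : ∀ m → Positive (ℕtoℚ (suc m))
  ℕtoℚ-suc-positive m = subst Positive (sym (ℤtoℚ≡mkℚ (ℤ.+ suc m))) _

  *-cancelʳ-≡-pos : ∀ {p q} r .{{_ : Positive r}} → p * r ≡ q * r → p ≡ q
  *-cancelʳ-≡-pos r eq =
    ≤-antisym (*-cancelʳ-≤-pos r (≤-reflexive eq)) (*-cancelʳ-≤-pos r (≤-reflexive (sym eq)))

  ≤∧≢⇒< : ∀ {p q} → p ≤ q → p ≢ q → p < q
  ≤∧≢⇒< {p} {q} p≤q p≢q with p <? q
  ... | yes p<q = p<q
  ... | no  p≮q = contradiction (≤-antisym p≤q (≮⇒≥ p≮q)) p≢q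

  -- The embedding is a parameter and floorBelow is opaque so that the type
  -- checker never unfolds ℕtoℚ: its normal form goes through gcd, and
  -- computing it on open terms exhausts memory.
  module Floor (⟦_⟧ : ℕ → ℚ) where

    record IsFloor (m : ℕ) (x : ℚ) : Set where
      constructor isFloor
      field
        lower : ⟦ m ⟧ ≤ x
        upper : x < ⟦ suc m ⟧

    opaque
      floorBelow : ℕ → ℚ → ℕ
      floorBelow zero    x = zero
      floorBelow (suc b) x with ⟦ b ⟧ ≤? x
      ... | yes _ = b
      ... | no  _ = floorBelow b x

      floorBelow-spec : ∀ b {x} → ⟦ 0 ⟧ ≤ x → x < ⟦ b ⟧ →
        floorBelow b x ℕ.< b × IsFloor (floorBelow b x) x
      floorBelow-spec zero    0≤x x<0 = ⊥-elim (<-irrefl refl (≤-<-trans 0≤x x<0))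
      floorBelow-spec (suc b) {x} 0≤x x<b+1 with ⟦ b ⟧ ≤? x
      ... | yes b≤x = ℕ.≤-refl , isFloor b≤x x<b+1
      ... | no  b≰x =
        let b′<b , ⌊x⌋ = floorBelow-spec b 0≤x (≰⇒> b≰x) in ℕ.m<n⇒m<1+n b′<b , ⌊x⌋

  open Floor ℕtoℚ public

  integer-shift-< : ∀ {a b x y m} → a ℤ.< b → IsFloor m x → IsFloor m y → ℤtoℚ a + x < ℤtoℚ b + y
  integer-shift-< {a} {b} {x} {y} {m} a<b (isFloor _ x<m+1) (isFloor m≤y _) = begin-strict
    ℤtoℚ a + x               <⟨ +-monoʳ-< (ℤtoℚ a) x<m+1 ⟩
    ℤtoℚ a + ℕtoℚ (suc m)    ≡⟨ cong (ℤtoℚ a +_) (ℕtoℚ-suc m) ⟩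
    ℤtoℚ a + (1ℚ + ℕtoℚ m)   ≡⟨ shuffle (ℤtoℚ a) (ℕtoℚ m) ⟩
    (1ℚ + ℤtoℚ a) + ℕtoℚ m   ≡⟨ cong (_+ ℕtoℚ m) (sym (ℤtoℚ-+ ℤ.1ℤ a)) ⟩
    ℤtoℚ (ℤ.suc a) + ℕtoℚ m  ≤⟨ +-monoˡ-≤ (ℕtoℚ m) (ℤtoℚ-mono-≤ (ℤ.i<j⇒suc[i]≤j a<b)) ⟩
    ℤtoℚ b + ℕtoℚ m          ≤⟨ +-monoʳ-≤ (ℤtoℚ b) m≤y ⟩
    ℤtoℚ b + y               ∎
    where
    open ≤-Reasoning
    shuffle : ∀ A M → A + (1ℚ + M) ≡ (1ℚ + A) + M
    shuffle = solve-∀ ℚ-ring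

  ≡-if-same-floor : ∀ {a b x y m} → ℤtoℚ a + x ≡ ℤtoℚ b + y → IsFloor m x → IsFloor m y → x ≡ y
  ≡-if-same-floor {a} {b} eq ⌊x⌋ ⌊y⌋ with ℤ.<-cmp a b
  ... | tri< a<b _ _  = ⊥-elim (<-irrefl eq (integer-shift-< a<b ⌊x⌋ ⌊y⌋))
  ... | tri≈ _ refl _ = ∙-cancelˡ (ℤtoℚ a) _ _ eq
  ... | tri> _ _ b<a  = ⊥-elim (<-irrefl (sym eq) (integer-shift-< b<a ⌊y⌋ ⌊x⌋))

  Weights : Set
  Weights = List (ℚ × ℕ)

  wsum : Weights → (ℕ → ℚ) → ℚ
  wsum []             f = 0ℚ
  wsum ((c , k) ∷ ws) f = c * f k + wsum ws f

  total : Weights → ℚ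
  total ws = sumℚ (map proj₁ ws)

  NonNegativeWeights : Weights → Set
  NonNegativeWeights = All (λ w → 0ℚ ≤ proj₁ w)

  indicator : ℕ → ℕ → ℚ
  indicator j k with k ℕ.≟ j
  ... | yes _ = 1ℚ
  ... | no  _ = 0ℚ

  override : (ℕ → ℚ) → ℕ → ℚ → ℕ → ℚ
  override f j a k with k ℕ.≟ j
  ... | yes _ = a
  ... | no  _ = f k

  mass : Weights → ℕ → ℚ
  mass ws j = wsum ws (indicator j)

  wsum-cong : ∀ ws {f g} → (∀ k → f k ≡ g k) → wsum ws f ≡ wsum ws g
  wsum-cong []             f≗g = refl
  wsum-cong ((c , k) ∷ ws) f≗g = cong₂ (λ x y → c * x + y) (f≗g k) (wsum-cong ws f≗g)

  wsum-+ : ∀ ws f g → wsum ws (λ k → f k + g k) ≡ wsum ws f + wsum ws g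
  wsum-+ []             f g = sym (+-identityʳ 0ℚ)
  wsum-+ ((c , k) ∷ ws) f g rewrite wsum-+ ws f g = distrib c (f k) (g k) (wsum ws f) (wsum ws g)
    where
    distrib : ∀ c x y F G → c * (x + y) + (F + G) ≡ (c * x + F) + (c * y + G)
    distrib = solve-∀ ℚ-ring

  wsum-*ʳ : ∀ ws f a → wsum ws (λ k → f k * a) ≡ wsum ws f * a
  wsum-*ʳ []             f a = sym (*-zeroˡ a)
  wsum-*ʳ ((c , k) ∷ ws) f a rewrite wsum-*ʳ ws f a = distrib c (f k) a (wsum ws f)
    where
    distrib : ∀ c x a F → c * (x * a) + F * a ≡ (c * x + F) * a
    distrib = solve-∀ ℚ-ring

  wsum-const : ∀ ws a → wsum ws (λ _ → a) ≡ total ws * a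
  wsum-const []             a = sym (*-zeroˡ a)
  wsum-const ((c , k) ∷ ws) a rewrite wsum-const ws a = sym (*-distribʳ-+ a c (total ws))

  wsum-mono : ∀ {ws f g} → NonNegativeWeights ws → (∀ k → f k ≤ g k) → wsum ws f ≤ wsum ws g
  wsum-mono {[]}           []         f≤g = ≤-refl
  wsum-mono {(c , k) ∷ ws} (0≤c ∷ nn) f≤g =
    +-mono-≤ (*-monoˡ-≤-nonNeg c {{nonNegative 0≤c}} (f≤g k)) (wsum-mono nn f≤g)

  0≤1 : 0ℚ ≤ 1ℚ
  0≤1 = *≤* (ℤ.+≤+ ℕ.z≤n)

  wsum-override : ∀ ws f j a → wsum ws f ≡ wsum ws (override f j a) + mass ws j * (f j - a)
  wsum-override ws f j a = begin
    wsum ws f                                                            ≡⟨ wsum-cong ws split ⟩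
    wsum ws (λ k → override f j a k + indicator j k * (f j - a))          ≡⟨ wsum-+ ws _ _ ⟩
    wsum ws (override f j a) + wsum ws (λ k → indicator j k * (f j - a))
      ≡⟨ cong (wsum ws (override f j a) +_) (wsum-*ʳ ws (indicator j) _) ⟩
    wsum ws (override f j a) + mass ws j * (f j - a)                     ∎
    where
    open ≡-Reasoning
    split : ∀ k → f k ≡ override f j a k + indicator j k * (f j - a)
    split k with k ℕ.≟ j
    ... | yes refl = on-pivot (f k) a
      where
      on-pivot : ∀ x a → x ≡ a + 1ℚ * (x - a)
      on-pivot = solve-∀ ℚ-ring
    ... | no  _    = off-pivot (f k) (f j - a)
      where
      off-pivot : ∀ x y → x ≡ x + 0ℚ * y
      off-pivot = solve-∀ ℚ-ring

  wsum-determined : ∀ N ws ws′ {f a} → (∀ {k} → N ℕ.≤ k → f k ≡ a) → total ws ≡ total ws′ →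
    (∀ {k} → k ℕ.< N → mass ws k ≡ mass ws′ k) → wsum ws f ≡ wsum ws′ f
  wsum-determined zero ws ws′ {f} {a} f≡a tot≡ _ = begin
    wsum ws f           ≡⟨ wsum-cong ws (λ k → f≡a ℕ.z≤n) ⟩
    wsum ws (λ _ → a)   ≡⟨ wsum-const ws a ⟩
    total ws * a        ≡⟨ cong (_* a) tot≡ ⟩
    total ws′ * a       ≡⟨ sym (wsum-const ws′ a) ⟩
    wsum ws′ (λ _ → a)  ≡⟨ wsum-cong ws′ (λ k → sym (f≡a ℕ.z≤n)) ⟩
    wsum ws′ f          ∎
    where open ≡-Reasoning
  wsum-determined (suc N) ws ws′ {f} {a} f≡a tot≡ mass≡ = begin
    wsum ws f                                    ≡⟨ wsum-override ws f N a ⟩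
    wsum ws (override f N a) + mass ws N * (f N - a)
      ≡⟨ cong₂ (λ x m → x + m * (f N - a))
               (wsum-determined N ws ws′ g≡a tot≡ (mass≡ ∘ ℕ.m<n⇒m<1+n)) (mass≡ ℕ.≤-refl) ⟩
    wsum ws′ (override f N a) + mass ws′ N * (f N - a) ≡⟨ sym (wsum-override ws′ f N a) ⟩
    wsum ws′ f                                   ∎
    where
    open ≡-Reasoning
    g≡a : ∀ {k} → N ℕ.≤ k → override f N a k ≡ a
    g≡a {k} N≤k with k ℕ.≟ N
    ... | yes _  = refl
    ... | no k≢N = f≡a (ℕ.≤∧≢⇒< N≤k (k≢N ∘ sym))

  wsum-pivot : ∀ ws ws′ {f j b d} → f j ≡ b → (∀ {k} → j ℕ.< k → f k ≡ b + d) →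
    total ws ≡ total ws′ → (∀ {k} → k ℕ.< j → mass ws k ≡ mass ws′ k) →
    wsum ws f + mass ws j * d ≡ wsum ws′ f + mass ws′ j * d
  wsum-pivot ws ws′ {f} {j} {b} {d} fj≡b f≡b+d tot≡ mass≡ =
    trans (shifted ws) (trans (wsum-determined j ws ws′ g≡b+d tot≡ mass≡) (sym (shifted ws′)))
    where
    g = override f j (b + d)
    g≡b+d : ∀ {k} → j ℕ.≤ k → g k ≡ b + d
    g≡b+d {k} j≤k with k ℕ.≟ j
    ... | yes _  = refl
    ... | no k≢j = f≡b+d (ℕ.≤∧≢⇒< j≤k (k≢j ∘ sym))
    cancel : ∀ W m b d → (W + m * (b - (b + d))) + m * d ≡ W
    cancel = solve-∀ ℚ-ring
    shifted : ∀ ws → wsum ws f + mass ws j * d ≡ wsum ws g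
    shifted ws = begin
      wsum ws f + mass ws j * d
        ≡⟨ cong (_+ mass ws j * d) (wsum-override ws f j (b + d)) ⟩
      (wsum ws g + mass ws j * (f j - (b + d))) + mass ws j * d
        ≡⟨ cong (λ y → (wsum ws g + mass ws j * (y - (b + d))) + mass ws j * d) fj≡b ⟩
      (wsum ws g + mass ws j * (b - (b + d))) + mass ws j * d
        ≡⟨ cancel (wsum ws g) (mass ws j) b d ⟩
      wsum ws g
        ∎
      where open ≡-Reasoning

  indicator-nonneg : ∀ j k → 0ℚ ≤ indicator j k
  indicator-nonneg j k with k ℕ.≟ j
  ... | yes _ = 0≤1
  ... | no  _ = ≤-refl

  indicator-≤-1 : ∀ j k → indicator j k ≤ 1ℚ
  indicator-≤-1 j k with k ℕ.≟ j
  ... | yes _ = ≤-refl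
  ... | no  _ = 0≤1

  indicator-disjoint : ∀ {j k} → j ≢ k → ∀ x → indicator j x + indicator k x ≤ 1ℚ
  indicator-disjoint {j} {k} j≢k x with x ℕ.≟ j | x ℕ.≟ k
  ... | yes refl | yes refl = contradiction refl j≢k
  ... | yes _    | no  _    = ≤-refl
  ... | no  _    | yes _    = ≤-refl
  ... | no  _    | no  _    = 0≤1

  module _ {ws : Weights} (nonneg : NonNegativeWeights ws) where

    mass-nonneg : ∀ j → 0ℚ ≤ mass ws j
    mass-nonneg j =
      subst (_≤ mass ws j) (trans (wsum-const ws 0ℚ) (*-zeroʳ (total ws))) (wsum-mono nonneg (indicator-nonneg j))

    module _ (total≡1 : total ws ≡ 1ℚ) where

      wsum-≤-1 : ∀ {f} → (∀ k → f k ≤ 1ℚ) → wsum ws f ≤ 1ℚ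
      wsum-≤-1 {f} f≤1 =
        subst (wsum ws f ≤_) (trans (wsum-const ws 1ℚ) (trans (cong (_* 1ℚ) total≡1) (*-identityʳ 1ℚ)))
              (wsum-mono nonneg f≤1)

      mass-<-1 : ∀ {j} → mass ws j ≢ 1ℚ → mass ws j < 1ℚ
      mass-<-1 {j} = ≤∧≢⇒< (wsum-≤-1 (indicator-≤-1 j))

      mass-at-vertex : ∀ {j} → mass ws j ≡ 1ℚ → ∀ k → mass ws k ≡ indicator j k
      mass-at-vertex {j} mⱼ≡1 k with k ℕ.≟ j
      ... | yes refl = mⱼ≡1
      ... | no  k≢j  = ≤-antisym mₖ≤0 (mass-nonneg k)
        where
        1+mₖ≤1 : 1ℚ + mass ws k ≤ 1ℚ
        1+mₖ≤1 = subst (λ m → m + mass ws k ≤ 1ℚ) mⱼ≡1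
                   (subst (_≤ 1ℚ) (wsum-+ ws _ _) (wsum-≤-1 (indicator-disjoint (k≢j ∘ sym))))
        mₖ≤0 : mass ws k ≤ 0ℚ
        mₖ≤0 = begin
          mass ws k                     ≡⟨ shift (mass ws k) ⟩
          - 1ℚ + (1ℚ + mass ws k)       ≤⟨ +-monoʳ-≤ (- 1ℚ) 1+mₖ≤1 ⟩
          - 1ℚ + 1ℚ                     ≡⟨ +-inverseˡ 1ℚ ⟩
          0ℚ                            ∎
          where
          open ≤-Reasoning
          shift : ∀ m → m ≡ - 1ℚ + (1ℚ + m)
          shift = solve-∀ ℚ-ring

  scaled-bounds : ∀ b {m} → 0ℚ ≤ m → m < 1ℚ →
    0ℚ ≤ m * ℕtoℚ (suc b) × m * ℕtoℚ (suc b) < ℕtoℚ (suc b)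
  scaled-bounds b {m} 0≤m m<1 =
    subst (_≤ m * r) (*-zeroˡ r) (*-monoʳ-≤-nonNeg r {{pos⇒nonNeg r {{r-pos}}}} 0≤m) ,
    subst (m * r <_) (*-identityˡ r) (*-monoˡ-<-pos r {{r-pos}} m<1)
    where
    r = ℕtoℚ (suc b)
    r-pos = ℕtoℚ-suc-positive b

open Rational

open import Data.Nat using (ℕ; zero; suc; _+_; _*_; _∸_; _⊓_; _≤_; _<_; z≤n; s≤s; z<s; _<ᵇ_; _!)
open import Data.Nat.Properties
  using (<⇒<ᵇ; <ᵇ-reflects-<; ≤-refl; ≤-trans; ≤-reflexive; <⇒≤; <⇒≱; n<1+n; m≤n⇒m≤1+n;
         m≤n⇒m<n∨m≡n; m<1+n⇒m<n∨m≡n; _<?_; ≮⇒≥; m≤n⇒∃[o]m+o≡n; m+n≤o⇒m≤o; m≤m+n; m≤n+m;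
         m∸n+n≡m; +-suc; +-comm; +-identityʳ; +-cancelʳ-≡; suc-injective; ⊓-idem; anyUpTo?)
open import Data.Nat.ListAction using (product)
open import Data.Nat.Tactic.RingSolver using (solve-∀)
open import Data.Integer as ℤ using (ℤ)
open import Data.Rational as ℚ using (ℚ; 0ℚ; 1ℚ)
import Data.Rational.Properties as ℚ
open import Data.List.Properties
  using (++-assoc; ++-identityʳ; map-upTo; length-++; length-++-sucʳ; length-map; length-upTo;
         length-replicate; length-zipWith; ∷-injectiveˡ; ∷-injectiveʳ)
open import Data.List.Relation.Unary.All.Properties using (++⁻ˡ; ++⁻ʳ) renaming (++⁺ to All-++⁺)
open import Data.List.Relation.Unary.Any using (here; there)
open import Data.List.Relation.Unary.Unique.Propositional using (Unique; []; _∷_)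
open import Data.List.Membership.Propositional using (_∈_)
open import Data.List.Membership.Propositional.Properties
  using (∈-∃++; ∈-++⁻; ∈-++⁺ˡ; ∈-++⁺ʳ; ∈-map⁺; ∈-upTo⁺; ∈-cartesianProductWith⁺)
open import Data.List.Relation.Binary.Subset.Propositional using (_⊆_)
open import Data.List.Relation.Binary.Permutation.Propositional
  using (_↭_; ↭-refl; ↭-sym; ↭-trans; module PermutationReasoning)
open import Data.List.Relation.Binary.Permutation.Propositional.Properties
  using (++⁺; ++⁺ˡ; shift; shifts; drop-mid; ∈-resp-↭; All-resp-↭; ↭-empty-inv; ↭-length)
open import Data.Sum.Properties using (inj₂-injective)
open import Data.Bool using (true; false)
open import Relation.Nullary.Reflects using (ofʸ)

consecutive : ℕ → ℕ → List ℕ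
consecutive a zero    = []
consecutive a (suc b) = a ∷ consecutive (suc a) b

consecutive-∷ʳ : ∀ a b → consecutive a (suc b) ≡ consecutive a b ∷ʳ (a + b)
consecutive-∷ʳ a zero    = cong [_] (sym (+-identityʳ a))
consecutive-∷ʳ a (suc b) rewrite +-suc a b = cong (a ∷_) (consecutive-∷ʳ (suc a) b)

consecutive-< : ∀ a b → All (_< a + b) (consecutive a b)
consecutive-< a zero    = []
consecutive-< a (suc b) rewrite +-suc a b = s≤s (m≤m+n a b) ∷ consecutive-< (suc a) b

applyUpTo-consecutive : ∀ {f : ℕ → ℕ} a n → (∀ i → f i ≡ a + i) → applyUpTo f n ≡ consecutive a n
applyUpTo-consecutive a zero    f≗ = refl
applyUpTo-consecutive a (suc n) f≗ =
  cong₂ _∷_ (trans (f≗ 0) (+-identityʳ a))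
            (applyUpTo-consecutive (suc a) n (λ i → trans (f≗ (suc i)) (+-suc a i)))

map-suc-upTo : ∀ n → map suc (upTo n) ≡ consecutive 1 n
map-suc-upTo n = trans (map-upTo suc n) (applyUpTo-consecutive 1 n (λ _ → refl))

nth : {A : Set} → A → ℕ → List A → A
nth d _       []       = d
nth d zero    (x ∷ xs) = x
nth d (suc i) (x ∷ xs) = nth d i xs

nth-++ʳ : ∀ {A : Set} {d : A} {m} δ {L} i → length δ ≡ m → nth d (i + m) (δ ++ L) ≡ nth d i L
nth-++ʳ {d = d} [] {L} i refl = cong (λ j → nth d j L) (+-identityʳ i)
nth-++ʳ (x ∷ δ) i refl rewrite +-suc i (length δ) = nth-++ʳ δ i refl

nth-consecutive : ∀ {d a b i} → i < b → nth d i (consecutive a b) ≡ a + i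
nth-consecutive {a = a} {i = zero}  (s≤s _)   = sym (+-identityʳ a)
nth-consecutive {a = a} {i = suc i} (s≤s i<b) = trans (nth-consecutive i<b) (sym (+-suc a i))

length-consecutive : ∀ a b → length (consecutive a b) ≡ b
length-consecutive a zero    = refl
length-consecutive a (suc b) = cong suc (length-consecutive (suc a) b)

nth-map : ∀ {A B : Set} (f : A → B) {d} i xs → nth (f d) i (map f xs) ≡ f (nth d i xs)
nth-map f i       []       = refl
nth-map f zero    (x ∷ xs) = refl
nth-map f (suc i) (x ∷ xs) = nth-map f i xs

nth-replicate : ∀ {A : Set} {d : A} n i → nth d i (replicate n d) ≡ d
nth-replicate zero    i       = refl
nth-replicate (suc n) zero    = refl
nth-replicate (suc n) (suc i) = nth-replicate n i

nth-zipWith : ∀ {A B C : Set} (f : A → B → C) {da db dc} xs ys {i} → i < length xs → i < length ys →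
  nth dc i (zipWith f xs ys) ≡ f (nth da i xs) (nth db i ys)
nth-zipWith f (x ∷ xs) (y ∷ ys) {zero}  _         _         = refl
nth-zipWith f (x ∷ xs) (y ∷ ys) {suc i} (s≤s i<m) (s≤s i<n) = nth-zipWith f xs ys i<m i<n

nth-ext : ∀ {A : Set} (d : A) xs ys → length xs ≡ length ys →
  (∀ {i} → i < length xs → nth d i xs ≡ nth d i ys) → xs ≡ ys
nth-ext d []       []       _   _   = refl
nth-ext d (x ∷ xs) (y ∷ ys) len nth≡ =
  cong₂ _∷_ (nth≡ z<s) (nth-ext d xs ys (suc-injective len) (nth≡ ∘ s≤s))

-- Stack sorting

popWhile-split : ∀ x st → proj₁ (popWhile x st) ++ proj₂ (popWhile x st) ≡ st
popWhile-split x []       = refl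
popWhile-split x (t ∷ st) with t <ᵇ x
... | true  = cong (t ∷_) (popWhile-split x st)
... | false = refl

popWhile-All : ∀ {P : ℕ → Set} x {st} → All P st → All P (proj₂ (popWhile x st))
popWhile-All x []                 = []
popWhile-All x {t ∷ st} (pt ∷ ps) with t <ᵇ x
... | true  = popWhile-All x ps
... | false = pt ∷ ps

popWhile-all : ∀ {x st} → All (_< x) st → popWhile x st ≡ (st , [])
popWhile-all []                 = refl
popWhile-all {x} {t ∷ st} (t<x ∷ st<x) with t <ᵇ x | <⇒<ᵇ t<x
... | true | _ rewrite popWhile-all st<x = refl

popWhile-∷ʳ : ∀ {x M} st → x ≤ M →
  popWhile x (st ∷ʳ M) ≡ (proj₁ (popWhile x st) , proj₂ (popWhile x st) ∷ʳ M)
popWhile-∷ʳ {x} {M} [] x≤M with M <ᵇ x | <ᵇ-reflects-< M x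
... | true  | ofʸ M<x = ⊥-elim (<⇒≱ M<x x≤M)
... | false | _       = refl
popWhile-∷ʳ {x} (t ∷ st) x≤M with t <ᵇ x
... | true  rewrite popWhile-∷ʳ st x≤M = refl
... | false = refl

stackGo-∷ʳ : ∀ {M} xs st → All (_≤ M) xs → stackGo xs (st ∷ʳ M) ≡ stackGo xs st ∷ʳ M
stackGo-∷ʳ         []       st []          = refl
stackGo-∷ʳ {M} (x ∷ xs) st (x≤M ∷ xs≤M) rewrite popWhile-∷ʳ st x≤M =
  let (p , r) = popWhile x st in
  trans (cong (p ++_) (stackGo-∷ʳ xs (x ∷ r) xs≤M)) (sym (++-assoc p _ [ M ]))

stackGo-↭ : ∀ xs st → stackGo xs st ↭ xs ++ st
stackGo-↭ []       st = ↭-refl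
stackGo-↭ (x ∷ xs) st = begin
  p ++ stackGo xs (x ∷ r) ↭⟨ ++⁺ˡ p (stackGo-↭ xs (x ∷ r)) ⟩
  p ++ xs ++ x ∷ r        ↭⟨ shifts p xs ⟩
  xs ++ p ++ [ x ] ++ r   ↭⟨ ++⁺ˡ xs (shift x p r) ⟩
  xs ++ x ∷ p ++ r        ↭⟨ shift x xs (p ++ r) ⟩
  x ∷ xs ++ p ++ r        ≡⟨ cong (λ l → x ∷ xs ++ l) (popWhile-split x st) ⟩
  x ∷ xs ++ st            ∎
  where
  open PermutationReasoning
  p = proj₁ (popWhile x st)
  r = proj₂ (popWhile x st)

s-↭ : ∀ xs → s xs ↭ xs
s-↭ xs = subst (s xs ↭_) (++-identityʳ xs) (stackGo-↭ xs [])

stackGo-++-max : ∀ {M} α β st → All (_< M) α → All (_< M) st → All (_≤ M) β →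
  stackGo (α ++ M ∷ β) st ≡ stackGo α st ++ s β ++ [ M ]
stackGo-++-max {M} [] β st [] st<M β≤M rewrite popWhile-all st<M =
  cong (st ++_) (stackGo-∷ʳ β [] β≤M)
stackGo-++-max {M} (x ∷ α) β st (x<M ∷ α<M) st<M β≤M =
  let (p , r) = popWhile x st in
  trans (cong (p ++_) (stackGo-++-max α β (x ∷ r) α<M (x<M ∷ popWhile-All x st<M) β≤M))
        (sym (++-assoc p _ _))

s-++-max : ∀ {M} α β → All (_< M) α → All (_≤ M) β → s (α ++ M ∷ β) ≡ s α ++ s β ++ [ M ]
s-++-max α β α<M β≤M = stackGo-++-max α β [] α<M [] β≤M

s-++-consecutive : ∀ {a} X b → All (_< a) X → s (X ++ consecutive a b) ≡ s X ++ consecutive a b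
s-++-consecutive     X zero    _   = trans (cong s (++-identityʳ X)) (sym (++-identityʳ (s X)))
s-++-consecutive {a} X (suc b) X<a = begin
  s (X ++ a ∷ consecutive (suc a) b)   ≡⟨ cong s (sym (++-assoc X [ a ] _)) ⟩
  s ((X ++ [ a ]) ++ consecutive (suc a) b)
    ≡⟨ s-++-consecutive (X ++ [ a ]) b (All-++⁺ (All.map m≤n⇒m≤1+n X<a) (n<1+n a ∷ [])) ⟩
  s (X ++ [ a ]) ++ consecutive (suc a) b ≡⟨ cong (_++ consecutive (suc a) b) (s-++-max X [] X<a []) ⟩
  (s X ++ [ a ]) ++ consecutive (suc a) b ≡⟨ ++-assoc (s X) [ a ] _ ⟩
  s X ++ a ∷ consecutive (suc a) b     ∎
  where open ≡-Reasoning

s-remove-max : ∀ {a c δ} → δ ↭ consecutive a (suc c) →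
  ∃ λ δ′ → s δ ≡ δ′ ++ [ a + c ] × δ′ ↭ consecutive a c
s-remove-max {a} {c} {δ} δ↭ with ∈-∃++ (∈-resp-↭ (↭-sym δ↭) max∈)
  where
  max∈ : a + c ∈ consecutive a (suc c)
  max∈ = subst (a + c ∈_) (sym (consecutive-∷ʳ a c)) (∈-++⁺ʳ (consecutive a c) (here refl))
... | δ₁ , δ₂ , refl = s δ₁ ++ s δ₂ , s-δ , ↭-trans (++⁺ (s-↭ δ₁) (s-↭ δ₂)) rest↭
  where
  rest↭ : δ₁ ++ δ₂ ↭ consecutive a c
  rest↭ = subst (δ₁ ++ δ₂ ↭_) (++-identityʳ _)
            (drop-mid δ₁ (consecutive a c) (subst (δ₁ ++ a + c ∷ δ₂ ↭_) (consecutive-∷ʳ a c) δ↭))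
  rest<max : All (_< a + c) (δ₁ ++ δ₂)
  rest<max = All-resp-↭ (↭-sym rest↭) (consecutive-< a c)
  s-δ : s (δ₁ ++ a + c ∷ δ₂) ≡ (s δ₁ ++ s δ₂) ++ [ a + c ]
  s-δ = trans (s-++-max δ₁ δ₂ (++⁻ˡ δ₁ rest<max) (All.map <⇒≤ (++⁻ʳ δ₁ rest<max)))
              (sym (++-assoc (s δ₁) (s δ₂) _))

iter-↭ : ∀ k π → iter k π ↭ π
iter-↭ zero    π = ↭-refl
iter-↭ (suc k) π = ↭-trans (s-↭ (iter k π)) (iter-↭ k π)

-- Counting by injection into a finite list

box : List ℕ → List (List ℕ)
box []       = [ [] ]
box (b ∷ bs) = cartesianProductWith _∷_ (upTo b) (box bs)

length-cartesianProductWith : ∀ {A B C : Set} (f : A → B → C) xs ys →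
  length (cartesianProductWith f xs ys) ≡ length xs * length ys
length-cartesianProductWith f []       ys = refl
length-cartesianProductWith f (x ∷ xs) ys =
  trans (length-++ (map (f x) ys)) (cong₂ _+_ (length-map (f x) ys) (length-cartesianProductWith f xs ys))

length-box : ∀ bs → length (box bs) ≡ product bs
length-box []       = refl
length-box (b ∷ bs) =
  trans (length-cartesianProductWith _∷_ (upTo b) (box bs)) (cong₂ _*_ (length-upTo b) (length-box bs))

applyUpTo-∈-box : ∀ {f b : ℕ → ℕ} n → (∀ {j} → j < n → f j < b j) →
  applyUpTo f n ∈ box (applyUpTo b n)
applyUpTo-∈-box zero    f<b = here refl
applyUpTo-∈-box (suc n) f<b =
  ∈-cartesianProductWith⁺ _∷_ (∈-upTo⁺ (f<b z<s)) (applyUpTo-∈-box n (f<b ∘ s≤s))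

applyUpTo-≡⁻ : ∀ {A : Set} {f g : ℕ → A} n → applyUpTo f n ≡ applyUpTo g n →
  ∀ {j} → j < n → f j ≡ g j
applyUpTo-≡⁻ (suc n) eq {zero}  _         = ∷-injectiveˡ eq
applyUpTo-≡⁻ (suc n) eq {suc j} (s≤s j<n) = applyUpTo-≡⁻ n (∷-injectiveʳ eq) j<n

product-countdown : ∀ n → product (applyUpTo (λ j → suc (n ∸ suc j)) n) ≡ n !
product-countdown zero    = refl
product-countdown (suc n) = cong (suc n *_) (product-countdown n)

∈-++-∷⁻ : ∀ {A : Set} {x y : A} xs {ys} → y ∈ xs ++ x ∷ ys → y ≢ x → y ∈ xs ++ ys
∈-++-∷⁻ xs y∈ y≢x with ∈-++⁻ xs y∈
... | inj₁ y∈xs         = ∈-++⁺ˡ y∈xs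
... | inj₂ (here y≡x)   = contradiction y≡x y≢x
... | inj₂ (there y∈ys) = ∈-++⁺ʳ xs y∈ys

unique-⊆⇒length-≤ : ∀ {A : Set} {xs ys : List A} → Unique xs → xs ⊆ ys → length xs ≤ length ys
unique-⊆⇒length-≤ {xs = []}     _          _     = z≤n
unique-⊆⇒length-≤ {xs = x ∷ xs} (x∉xs ∷ u) xs⊆ys with ∈-∃++ (xs⊆ys (here refl))
... | ys₁ , ys₂ , refl =
  subst (suc (length xs) ≤_) (sym (length-++-sucʳ ys₁ x ys₂)) (s≤s (unique-⊆⇒length-≤ u xs⊆rest))
  where
  xs⊆rest : xs ⊆ ys₁ ++ ys₂
  xs⊆rest y∈xs = ∈-++-∷⁻ ys₁ (xs⊆ys (there y∈xs)) (λ y≡x → All.lookup x∉xs y∈xs (sym y≡x))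

module _ {A B : Set} {P : A → Set} (f : ∀ {x} → P x → B)
         (f-injective : ∀ {x y} (px : P x) (py : P y) → f px ≡ f py → x ≡ y) where

  private
    length-reduce : ∀ {xs} (pxs : All P xs) → length (reduce f pxs) ≡ length xs
    length-reduce []         = refl
    length-reduce (px ∷ pxs) = cong suc (length-reduce pxs)

    reduce-≢ : ∀ {x xs} (px : P x) → All (x ≢_) xs → (pxs : All P xs) → All (f px ≢_) (reduce f pxs)
    reduce-≢ px []           []         = []
    reduce-≢ px (x≢y ∷ x≢ys) (py ∷ pys) = (x≢y ∘ f-injective px py) ∷ reduce-≢ px x≢ys pys

    reduce-unique : ∀ {xs} → Unique xs → (pxs : All P xs) → Unique (reduce f pxs)
    reduce-unique []           []         = []
    reduce-unique (x∉xs ∷ u)   (px ∷ pxs) = reduce-≢ px x∉xs pxs ∷ reduce-unique u pxs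

  injection-length-≤ : ∀ {xs ys} → (∀ {x} (px : P x) → f px ∈ ys) → Unique xs → All P xs →
    length xs ≤ length ys
  injection-length-≤ {ys = ys} f∈ys u pxs =
    subst (_≤ length ys) (length-reduce pxs) (unique-⊆⇒length-≤ (reduce-unique u pxs) (reduce-⊆ pxs))
    where
    reduce-⊆ : ∀ {xs} (pxs : All P xs) → reduce f pxs ⊆ ys
    reduce-⊆ (px ∷ pxs) (here refl) = f∈ys px
    reduce-⊆ (px ∷ pxs) (there y∈) = reduce-⊆ pxs y∈

module _ {n π} (length-iter : ∀ k → length (iter k π) ≡ n) where

  length-combo : ∀ ws → length (combo n π ws) ≡ n
  length-combo []             = length-replicate n
  length-combo ((c , k) ∷ ws) =
    trans (length-zipWith _ (iter k π) (combo n π ws))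
          (trans (cong₂ _⊓_ (length-iter k) (length-combo ws)) (⊓-idem n))

  nth-combo : ∀ ws {i} → i < n → nth 0ℚ i (combo n π ws) ≡ wsum ws (λ k → ℕtoℚ (nth 0 i (iter k π)))
  nth-combo []             {i} _   = nth-replicate n i
  nth-combo ((c , k) ∷ ws) {i} i<n =
    trans (nth-zipWith _ (iter k π) (combo n π ws) (≤-trans i<n (≤-reflexive (sym (length-iter k))))
                                                   (≤-trans i<n (≤-reflexive (sym (length-combo ws)))))
          (cong (c ℚ.* ℕtoℚ (nth 0 i (iter k π)) ℚ.+_) (nth-combo ws i<n))

module Ln1Orbit (c₀ : ℕ) (xs : List ℕ) (π↭ : xs ++ 2 + c₀ ∷ 1 ∷ [] ↭ consecutive 1 (2 + c₀)) where

  π : List ℕ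
  π = xs ++ 2 + c₀ ∷ 1 ∷ []

  xs↭ : xs ↭ consecutive 2 c₀
  xs↭ = subst₂ _↭_ (++-identityʳ xs) (++-identityʳ _) (drop-mid xs (consecutive 2 c₀) without-1)
    where
    without-1 : xs ++ [ 2 + c₀ ] ↭ consecutive 2 c₀ ++ [ 2 + c₀ ]
    without-1 = subst₂ _↭_ (++-identityʳ _) (consecutive-∷ʳ 2 c₀)
      (drop-mid (xs ++ [ 2 + c₀ ]) [] (subst (_↭ 1 ∷ consecutive 2 (suc c₀)) (sym (++-assoc xs _ _)) π↭))

  stage : ∀ k c → k + c ≡ c₀ →
    ∃ λ δ → δ ↭ consecutive 2 c × iter k π ≡ δ ++ 2 + c ∷ 1 ∷ consecutive (3 + c) k
  stage zero    c refl = xs , xs↭ , refl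
  stage (suc k) c k+c≡c₀ with stage k (suc c) (trans (+-suc k c) k+c≡c₀)
  ... | δ , δ↭ , iterₖ with s-remove-max δ↭
  ... | δ′ , sδ , δ′↭ = δ′ , δ′↭ , (begin
    s (iter k π)                                        ≡⟨ cong s iterₖ ⟩
    s (δ ++ 3 + c ∷ 1 ∷ consecutive (4 + c) k)          ≡⟨ cong s (sym (++-assoc δ (3 + c ∷ [ 1 ]) _)) ⟩
    s ((δ ++ 3 + c ∷ [ 1 ]) ++ consecutive (4 + c) k)   ≡⟨ s-++-consecutive _ k below-4+c ⟩
    s (δ ++ 3 + c ∷ [ 1 ]) ++ consecutive (4 + c) k     ≡⟨ cong (_++ _) (s-++-max δ [ 1 ] δ<3+c (z<s ∷ [])) ⟩
    (s δ ++ 1 ∷ [ 3 + c ]) ++ consecutive (4 + c) k     ≡⟨ cong (λ l → (l ++ 1 ∷ [ 3 + c ]) ++ _) sδ ⟩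
    ((δ′ ++ [ 2 + c ]) ++ 1 ∷ [ 3 + c ]) ++ consecutive (4 + c) k
      ≡⟨ trans (++-assoc (δ′ ++ [ 2 + c ]) _ _) (++-assoc δ′ [ 2 + c ] _) ⟩
    δ′ ++ 2 + c ∷ 1 ∷ consecutive (3 + c) (suc k)       ∎)
    where
    open ≡-Reasoning
    δ<3+c : All (_< 3 + c) δ
    δ<3+c = All-resp-↭ (↭-sym δ↭) (consecutive-< 2 (suc c))
    below-4+c : All (_< 4 + c) (δ ++ 3 + c ∷ [ 1 ])
    below-4+c = All-++⁺ (All.map m≤n⇒m≤1+n δ<3+c) (n<1+n _ ∷ s≤s z<s ∷ [])

  identity : List ℕ
  identity = consecutive 1 (2 + c₀)

  sorted-from : ∀ {k} → suc c₀ ≤ k → iter k π ≡ identity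
  sorted-from {suc k} (s≤s c₀≤k) with m≤n⇒m<n∨m≡n c₀≤k
  ... | inj₁ c₀<k = trans (cong s (sorted-from c₀<k)) (s-++-consecutive [] (2 + c₀) [])
  ... | inj₂ refl with stage c₀ 0 (+-identityʳ c₀)
  ...   | δ , δ↭ , iter-c₀ rewrite ↭-empty-inv δ↭ =
    trans (cong s iter-c₀) (s-++-consecutive (2 ∷ [ 1 ]) c₀ (s≤s (s≤s z<s) ∷ s≤s z<s ∷ []))

  length-stage : ∀ {c δ} → δ ↭ consecutive 2 c → length δ ≡ c
  length-stage {c} δ↭ = trans (↭-length δ↭) (length-consecutive 2 c)

  one-on-antidiagonal : ∀ i j → suc i + j ≡ suc c₀ → nth 0 (suc i) (iter j π) ≡ 1
  one-on-antidiagonal i j i+j≡ with stage j i (trans (+-comm j i) (suc-injective i+j≡))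
  ... | δ , δ↭ , iterⱼ = trans (cong (nth 0 (suc i)) iterⱼ) (nth-++ʳ δ 1 (length-stage δ↭))

  sorted-after-antidiagonal : ∀ i j {k} → suc i + j ≡ suc c₀ → j < k →
    nth 0 (suc i) (iter k π) ≡ suc (suc i)
  sorted-after-antidiagonal i j {k} i+j≡ j<k with c₀ <? k
  ... | yes c₀<k = trans (cong (nth 0 (suc i)) (sorted-from c₀<k))
                         (nth-consecutive (s≤s (m+n≤o⇒m≤o (suc i) (≤-reflexive i+j≡))))
  ... | no c₀≮k with m≤n⇒∃[o]m+o≡n (≮⇒≥ c₀≮k) | m≤n⇒∃[o]m+o≡n j<k
  ...   | c , k+c≡c₀ | t , refl with stage (suc j + t) c k+c≡c₀
  ...     | δ , δ↭ , iterₖ = begin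
    nth 0 (suc i) (iter k π)                                    ≡⟨ cong₂ (nth 0) (cong suc i≡) iterₖ ⟩
    nth 0 ((2 + t) + c) (δ ++ 2 + c ∷ 1 ∷ consecutive (3 + c) k) ≡⟨ nth-++ʳ δ (2 + t) (length-stage δ↭) ⟩
    nth 0 t (consecutive (3 + c) k)                             ≡⟨ nth-consecutive (s≤s (m≤n+m t j)) ⟩
    3 + c + t                                                   ≡⟨ cong (3 +_) (+-comm c t) ⟩
    suc (suc (suc (t + c)))                                     ≡⟨ cong (suc ∘ suc) (sym i≡) ⟩
    suc (suc i)                                                 ∎
    where
    open ≡-Reasoning
    rearrange : ∀ j t c → suc j + t + c ≡ suc (t + c) + j
    rearrange = solve-∀
    i≡ : i ≡ suc (t + c)
    i≡ = +-cancelʳ-≡ j i (suc (t + c)) (begin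
      i + j               ≡⟨ suc-injective i+j≡ ⟩
      c₀                  ≡⟨ sym k+c≡c₀ ⟩
      suc j + t + c       ≡⟨ rearrange j t c ⟩
      suc (t + c) + j     ∎)

module Staircase (N : ℕ) (π : List ℕ)
  (sorted-from : ∀ {k} → N ≤ k → iter k π ≡ consecutive 1 (suc N))
  (one-on-antidiagonal : ∀ i j → suc i + j ≡ N → nth 0 (suc i) (iter j π) ≡ 1)
  (sorted-after-antidiagonal : ∀ i j {k} → suc i + j ≡ N → j < k →
                               nth 0 (suc i) (iter k π) ≡ suc (suc i))
  where

  length-iter : ∀ k → length (iter k π) ≡ suc N
  length-iter k = begin
    length (iter k π)            ≡⟨ ↭-length (iter-↭ k π) ⟩
    length π                     ≡⟨ sym (↭-length (iter-↭ N π)) ⟩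
    length (iter N π)            ≡⟨ cong length (sorted-from ≤-refl) ⟩
    length (consecutive 1 (suc N)) ≡⟨ length-consecutive 1 (suc N) ⟩
    suc N                        ∎
    where open ≡-Reasoning

  entry : ℕ → ℕ → ℚ
  entry i k = ℕtoℚ (nth 0 i (iter k π))

  entry-sorted-from : ∀ {i k} → i < suc N → N ≤ k → entry i k ≡ ℕtoℚ (suc i)
  entry-sorted-from {i} i<n N≤k =
    trans (cong (λ l → ℕtoℚ (nth 0 i l)) (sorted-from N≤k)) (cong ℕtoℚ (nth-consecutive i<n))

  LatticePoint : List ℤ → Set
  LatticePoint = LatticePointOf (suc N) π

  weights : ∀ {z} → LatticePoint z → Weights
  weights (_ , ws , _) = ws

  coord : List ℤ → ℕ → ℚ
  coord z i = ℤtoℚ (nth (ℤ.+ 0) i z)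

  coord-≡-wsum : ∀ {z} (p : LatticePoint z) {i} → i < suc N → coord z i ≡ wsum (weights p) (entry i)
  coord-≡-wsum {z} (_ , ws , _ , _ , z≡) {i} i<n = begin
    coord z i                       ≡⟨ sym (nth-map ℤtoℚ i z) ⟩
    nth 0ℚ i (map ℤtoℚ z)           ≡⟨ cong (nth 0ℚ i) z≡ ⟩
    nth 0ℚ i (combo (suc N) π ws)   ≡⟨ nth-combo length-iter ws i<n ⟩
    wsum ws (entry i)               ∎
    where open ≡-Reasoning

  determined-by-masses : ∀ {z z′} (p : LatticePoint z) (p′ : LatticePoint z′) →
    (∀ {k} → k < N → mass (weights p) k ≡ mass (weights p′) k) → z ≡ z′
  determined-by-masses {z} {z′} p@(len , ws , _ , total≡1 , _) p′@(len′ , ws′ , _ , total′≡1 , _) mass≡ =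
    nth-ext (ℤ.+ 0) z z′ (trans len (sym len′)) λ {i} i<len →
      let i<n = subst (i <_) len i<len in
      ℤtoℚ-injective (trans (coord-≡-wsum p i<n)
        (trans (wsum-determined N ws ws′ (entry-sorted-from i<n) (trans total≡1 (sym total′≡1)) mass≡)
               (sym (coord-≡-wsum p′ i<n))))

  pivot : ℕ → ℕ
  pivot j = N ∸ suc j

  pivot-antidiagonal : ∀ {j} → j < N → suc (pivot j) + j ≡ N
  pivot-antidiagonal {j} j<N = trans (sym (+-suc (pivot j) j)) (m∸n+n≡m j<N)

  scaled : Weights → ℕ → ℚ
  scaled ws j = mass ws j ℚ.* ℕtoℚ (suc (pivot j))

  pivot-coords-agree : ∀ {z z′} (p : LatticePoint z) (p′ : LatticePoint z′) {j} → j < N →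
    (∀ {k} → k < j → mass (weights p) k ≡ mass (weights p′) k) →
    coord z (suc (pivot j)) ℚ.+ scaled (weights p) j ≡ coord z′ (suc (pivot j)) ℚ.+ scaled (weights p′) j
  pivot-coords-agree {z} {z′} p@(_ , ws , _ , total≡1 , _) p′@(_ , ws′ , _ , total′≡1 , _) {j} j<N mass≡ =
    begin
    coord z (suc i) ℚ.+ scaled ws j          ≡⟨ cong (ℚ._+ scaled ws j) (coord-≡-wsum p i<n) ⟩
    wsum ws (entry (suc i)) ℚ.+ scaled ws j  ≡⟨ wsum-pivot ws ws′ one later (trans total≡1 (sym total′≡1)) mass≡ ⟩
    wsum ws′ (entry (suc i)) ℚ.+ scaled ws′ j ≡⟨ cong (ℚ._+ scaled ws′ j) (sym (coord-≡-wsum p′ i<n)) ⟩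
    coord z′ (suc i) ℚ.+ scaled ws′ j        ∎
    where
    open ≡-Reasoning
    i = pivot j
    on-diagonal = pivot-antidiagonal j<N
    i<n : suc i < suc N
    i<n = s≤s (m+n≤o⇒m≤o (suc i) (≤-reflexive on-diagonal))
    one : entry (suc i) j ≡ 1ℚ
    one = cong ℕtoℚ (one-on-antidiagonal i j on-diagonal)
    later : ∀ {k} → j < k → entry (suc i) k ≡ 1ℚ ℚ.+ ℕtoℚ (suc i)
    later j<k = trans (cong ℕtoℚ (sorted-after-antidiagonal i j on-diagonal j<k)) (ℕtoℚ-suc (suc i))

  floor-code : Weights → ℕ → ℕ
  floor-code ws j = floorBelow (suc (pivot j)) (scaled ws j)

  floor-code-spec : ∀ {ws} → NonNegativeWeights ws → total ws ≡ 1ℚ → ∀ {j} → mass ws j ≢ 1ℚ →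
    floor-code ws j < suc (pivot j) × IsFloor (floor-code ws j) (scaled ws j)
  floor-code-spec nonneg total≡1 {j} mⱼ≢1 =
    let 0≤sⱼ , sⱼ<b = scaled-bounds (pivot j) (mass-nonneg nonneg j) (mass-<-1 nonneg total≡1 mⱼ≢1)
    in floorBelow-spec (suc (pivot j)) 0≤sⱼ sⱼ<b

  Vertex : Weights → Set
  Vertex ws = ∃ λ j → j < N × mass ws j ≡ 1ℚ

  vertex? : ∀ ws → Dec (Vertex ws)
  vertex? ws = anyUpTo? (λ j → mass ws j ℚ.≟ 1ℚ) N

  Code : Set
  Code = ℕ ⊎ List ℕ

  codeWith : ∀ ws → Dec (Vertex ws) → Code
  codeWith ws (yes (j , _)) = inj₁ j
  codeWith ws (no _)        = inj₂ (applyUpTo (floor-code ws) N)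

  code : ∀ {z} → LatticePoint z → Code
  code p = codeWith (weights p) (vertex? (weights p))

  bounds : List ℕ
  bounds = applyUpTo (λ j → suc (pivot j)) N

  codes : List Code
  codes = map inj₁ (upTo N) ++ map inj₂ (box bounds)

  length-codes : length codes ≡ N + N !
  length-codes = begin
    length codes ≡⟨ length-++ (map inj₁ (upTo N)) ⟩
    length (map inj₁ (upTo N)) + length (map inj₂ (box bounds))
      ≡⟨ cong₂ _+_ (trans (length-map inj₁ (upTo N)) (length-upTo N))
                   (trans (length-map inj₂ (box bounds))
                          (trans (length-box bounds) (product-countdown N))) ⟩
    N + N ! ∎
    where open ≡-Reasoning

  code-∈-codes : ∀ {z} (p : LatticePoint z) → code p ∈ codes
  code-∈-codes (_ , ws , nonneg , total≡1 , _) with vertex? ws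
  ... | yes (j , j<N , _) = ∈-++⁺ˡ (∈-map⁺ inj₁ (∈-upTo⁺ j<N))
  ... | no ¬vertex = ∈-++⁺ʳ (map inj₁ (upTo N)) (∈-map⁺ inj₂ (applyUpTo-∈-box N λ j<N →
        proj₁ (floor-code-spec nonneg total≡1 (λ mⱼ≡1 → ¬vertex (_ , j<N , mⱼ≡1)))))

  mass-from-floor : ∀ {z z′} (p : LatticePoint z) (p′ : LatticePoint z′) {j} → j < N →
    mass (weights p) j ≢ 1ℚ → mass (weights p′) j ≢ 1ℚ →
    floor-code (weights p) j ≡ floor-code (weights p′) j →
    (∀ {k} → k < j → mass (weights p) k ≡ mass (weights p′) k) → mass (weights p) j ≡ mass (weights p′) j
  mass-from-floor {z} {z′} p@(_ , ws , nonneg , total≡1 , _) p′@(_ , ws′ , nonneg′ , total′≡1 , _)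
                  {j} j<N mⱼ≢1 m′ⱼ≢1 floor≡ earlier≡ =
    *-cancelʳ-≡-pos (ℕtoℚ (suc (pivot j))) {{ℕtoℚ-suc-positive (pivot j)}}
      (≡-if-same-floor {a = nth (ℤ.+ 0) (suc (pivot j)) z} {b = nth (ℤ.+ 0) (suc (pivot j)) z′}
        (pivot-coords-agree p p′ j<N earlier≡) ⌊sⱼ⌋ ⌊s′ⱼ⌋)
    where
    ⌊sⱼ⌋ : IsFloor (floor-code ws j) (scaled ws j)
    ⌊sⱼ⌋ = proj₂ (floor-code-spec nonneg total≡1 mⱼ≢1)
    ⌊s′ⱼ⌋ : IsFloor (floor-code ws j) (scaled ws′ j)
    ⌊s′ⱼ⌋ = subst (λ c → IsFloor c (scaled ws′ j)) (sym floor≡) (proj₂ (floor-code-spec nonneg′ total′≡1 m′ⱼ≢1))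

  masses-from-floors : ∀ {z z′} (p : LatticePoint z) (p′ : LatticePoint z′) →
    ¬ Vertex (weights p) → ¬ Vertex (weights p′) →
    applyUpTo (floor-code (weights p)) N ≡ applyUpTo (floor-code (weights p′)) N →
    ∀ {j} → j < N → mass (weights p) j ≡ mass (weights p′) j
  masses-from-floors p p′ ¬v ¬v′ floors≡ {j} j<N = agree-below (suc j) j<N ≤-refl
    where
    agree-below : ∀ m → m ≤ N → ∀ {k} → k < m → mass (weights p) k ≡ mass (weights p′) k
    agree-below (suc m) m<N k<1+m with m<1+n⇒m<n∨m≡n k<1+m
    ... | inj₁ k<m  = agree-below m (<⇒≤ m<N) k<m
    ... | inj₂ refl = mass-from-floor p p′ m<N (λ mₘ≡1 → ¬v (m , m<N , mₘ≡1)) (λ m′ₘ≡1 → ¬v′ (m , m<N , m′ₘ≡1))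
                        (applyUpTo-≡⁻ N floors≡ m<N) (agree-below m (<⇒≤ m<N))

  code-injective : ∀ {z z′} (p : LatticePoint z) (p′ : LatticePoint z′) → code p ≡ code p′ → z ≡ z′
  code-injective {z} {z′} p@(_ , ws , nonneg , total≡1 , _) p′@(_ , ws′ , nonneg′ , total′≡1 , _) =
    codeWith-injective (vertex? ws) (vertex? ws′)
    where
    codeWith-injective : (v : Dec (Vertex ws)) (v′ : Dec (Vertex ws′)) →
      codeWith ws v ≡ codeWith ws′ v′ → z ≡ z′
    codeWith-injective (yes (j , _ , mⱼ≡1)) (yes (.j , _ , m′ⱼ≡1)) refl =
      determined-by-masses p p′ λ {k} _ →
        trans (mass-at-vertex nonneg total≡1 mⱼ≡1 k) (sym (mass-at-vertex nonneg′ total′≡1 m′ⱼ≡1 k))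
    codeWith-injective (no ¬v) (no ¬v′) eq =
      determined-by-masses p p′ (masses-from-floors p p′ ¬v ¬v′ (inj₂-injective eq))
    codeWith-injective (yes _) (no _)  ()
    codeWith-injective (no _)  (yes _) ()

  lattice-points-≤ : ∀ {zs} → Unique zs → All LatticePoint zs → length zs ≤ N ! + N
  lattice-points-≤ {zs} unique points =
    subst (length zs ≤_) (trans length-codes (+-comm N (N !)))
      (injection-length-≤ code code-injective code-∈-codes unique points)

proposition5p5 : (n : ℕ) → 2 ≤ n → (π : List ℕ) → IsPerm n π → IsLn1 n π →
    (zs : List (List ℤ)) → Unique zs → All (LatticePointOf n π) zs →
    length zs ≤ (n ∸ 1) ! + (n ∸ 1)
proposition5p5 (suc (suc c₀)) (s≤s (s≤s z≤n)) π π↭ (xs , refl) zs unique points =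
  Staircase.lattice-points-≤ (suc c₀) π
    Orbit.sorted-from Orbit.one-on-antidiagonal Orbit.sorted-after-antidiagonal unique points
  where module Orbit = Ln1Orbit c₀ xs (subst (π ↭_) (map-suc-upTo (suc (suc c₀))) π↭)
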